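{- Let $h,n\ge 2$ and let $A_h$ be the alternating group on $[h]$. Then: (i) if $h\le n!$, then $O(A_h\times\{id\})=A_h\times\{id\}$; (ii) if $h>n!$, then $O(A_h\times\{id\})=S_h\times\{id\}$; (iii) $A_h\times\{id\}\in\mathrm{SPFAG}_h(n)$ if and only if $h\le n!$.
   Context: $G=S_h\times S_n$, $\mathcal P=(S_n)^h$, $G$ acting by $p^{(\varphi,\psi)}$ having $i$-th component $\psi\,p_{\varphi^{ -1}(i)}$ (products are compositions); $p^U=\{p^u:u\in U\}$. $U\le G$ is regular if $\{u\in U:p^u=p\}\subseteq S_h\times\{id\}$ for all $p$. For regular $U$: $V\le_{\mathcal P}U$ means $p^V\subseteq p^U$ for all $p$; $\mathcal A(U)=\{V\le G:V\text{ regular},V\ge U,V\le_{\mathcal P}U\}$; $O(U)=\langle\mathcal A(U)\rangle$. An SPF is a map $F:\mathcal P\to S_n$; its anonymity group is $G_1(F)=\{(\varphi,id)\in G:F(p^{(\varphi,id)})=F(p)\ \forall p\}$; $\mathrm{SPFAG}_h(n)=\{G_1(F)\}$ over all SPFs. -}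

module Defs where

open import Level using (0ℓ)
open import Data.Nat using (ℕ; _!)
open import Data.Nat.Divisibility using (_∣_)
open import Data.Fin using (Fin; _<?_)
open import Data.Vec using (Vec; lookup; tabulate; sum)
open import Data.Vec.Properties using (lookup∘tabulate)
open import Data.Product using (_×_; _,_; proj₁; proj₂; Σ-syntax)
open import Data.Bool using (if_then_else_; _∧_)
open import Function using (_∘_)
open import Relation.Nullary using (does)
open import Relation.Unary using (Pred; _∈_; _⊆_)
open import Relation.Binary.PropositionalEquality using (_≡_; refl; trans; cong)

-- The inverse-laws are irrelevant fields, so two
-- permutations are propositionally equal iff their tables agree
-- (and the 'from' table is determined by the 'to' table).

record Perm (k : ℕ) : Set where
  constructor mkPerm
  field
    to   : Vec (Fin k) k
    from : Vec (Fin k) k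
    .from-to : ∀ i → lookup from (lookup to i) ≡ i
    .to-from : ∀ i → lookup to (lookup from i) ≡ i

open Perm public

app : ∀ {k} → Perm k → Fin k → Fin k
app σ = lookup (to σ)

app⁻ : ∀ {k} → Perm k → Fin k → Fin k
app⁻ σ = lookup (from σ)

private
  lt : ∀ {k} (f : Fin k → Fin k) i → lookup (tabulate f) i ≡ f i
  lt f i = lookup∘tabulate f i

idP : ∀ {k} → Perm k
idP = mkPerm (tabulate (λ i → i)) (tabulate (λ i → i))
  (λ i → trans (lt (λ x → x) (lookup (tabulate (λ x → x)) i)) (lt (λ x → x) i))
  (λ i → trans (lt (λ x → x) (lookup (tabulate (λ x → x)) i)) (lt (λ x → x) i))

-- composition: (σ ∘ₚ τ) i = σ (τ i)
_∘ₚ_ : ∀ {k} → Perm k → Perm k → Perm k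
mkPerm t f ft tf ∘ₚ mkPerm t' f' ft' tf' =
  mkPerm (tabulate T) (tabulate F)
  (λ i → trans (lt F (lookup (tabulate T) i))
          (trans (cong F (lt T i))
           (trans (cong (lookup f') (ft (lookup t' i))) (ft' i))))
  (λ i → trans (lt T (lookup (tabulate F) i))
          (trans (cong T (lt F i))
           (trans (cong (lookup t) (tf' (lookup f i))) (tf i))))
  where
  T = λ i → lookup t (lookup t' i)
  F = λ i → lookup f' (lookup f i)

invP : ∀ {k} → Perm k → Perm k
invP (mkPerm t f ft tf) = mkPerm f t tf ft

inversions : ∀ {k} → Perm k → ℕ
inversions {k} σ =
  sum (tabulate λ (i : Fin k) → sum (tabulate λ (j : Fin k) →
    if does (i <? j) ∧ does (app σ j <? app σ i) then 1 else 0))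

IsEven : ∀ {k} → Perm k → Set
IsEven σ = 2 ∣ inversions σ

G : ℕ → ℕ → Set
G h n = Perm h × Perm n

eG : ∀ {h n} → G h n
eG = idP , idP

_·_ : ∀ {h n} → G h n → G h n → G h n
(φ , ψ) · (φ' , ψ') = (φ ∘ₚ φ') , (ψ ∘ₚ ψ')

_⁻¹ : ∀ {h n} → G h n → G h n
(φ , ψ) ⁻¹ = invP φ , invP ψ

Profile : ℕ → ℕ → Set
Profile h n = Vec (Perm n) h

act : ∀ {h n} → Profile h n → G h n → Profile h n
act p (φ , ψ) = tabulate (λ i → ψ ∘ₚ lookup p (app⁻ φ i))

Subset : ℕ → ℕ → Set₁
Subset h n = Pred (G h n) 0ℓ

record IsSubgroup {h n} (V : Subset h n) : Set where
  field
    has-e   : eG ∈ V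
    closed· : ∀ {a b} → a ∈ V → b ∈ V → (a · b) ∈ V
    closed⁻ : ∀ {a} → a ∈ V → (a ⁻¹) ∈ V

Regular : ∀ {h n} → Subset h n → Set
Regular {h} {n} U = ∀ (p : Profile h n) (u : G h n) → u ∈ U → act p u ≡ p → proj₂ u ≡ idP

_≤𝒫_ : ∀ {h n} → Subset h n → Subset h n → Set
_≤𝒫_ {h} {n} V U = ∀ (p : Profile h n) (v : G h n) → v ∈ V →
  Σ[ u ∈ G h n ] (u ∈ U × act p u ≡ act p v)

𝒜 : ∀ {h n} → Subset h n → Pred (Subset h n) 0ℓ
𝒜 U V = IsSubgroup V × Regular V × U ⊆ V × V ≤𝒫 U

data ⟨_⟩ {h n} (𝒮 : Pred (Subset h n) 0ℓ) : Pred (G h n) (Level.suc 0ℓ) where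
  gen : ∀ {V g} → 𝒮 V → g ∈ V → g ∈ ⟨ 𝒮 ⟩
  one : eG ∈ ⟨ 𝒮 ⟩
  mul : ∀ {a b} → a ∈ ⟨ 𝒮 ⟩ → b ∈ ⟨ 𝒮 ⟩ → (a · b) ∈ ⟨ 𝒮 ⟩
  inv : ∀ {a} → a ∈ ⟨ 𝒮 ⟩ → (a ⁻¹) ∈ ⟨ 𝒮 ⟩

O : ∀ {h n} → Subset h n → Pred (G h n) (Level.suc 0ℓ)
O U = ⟨ 𝒜 U ⟩

AhId : ∀ h n → Subset h n
AhId h n (φ , ψ) = IsEven φ × ψ ≡ idP

ShId : ∀ h n → Subset h n
ShId h n (φ , ψ) = ψ ≡ idP

SPF : ℕ → ℕ → Set
SPF h n = Profile h n → Perm n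

G₁ : ∀ {h n} → SPF h n → Subset h n
G₁ {h} {n} F (φ , ψ) = ψ ≡ idP × (∀ (p : Profile h n) → F (act p (φ , idP)) ≡ F p)

InSPFAG : ∀ h n → Subset h n → Set
InSPFAG h n U = Σ[ F ∈ SPF h n ] (G₁ F ≐' U)
  where
  _≐'_ : Subset h n → Subset h n → Set
  A ≐' B = A ⊆ B × B ⊆ A

-- The sign of a permutation is the parity of the number of pairs it puts in discordant order;
-- counting discordant pairs satisfies a triangle identity modulo 2, so the sign is a
-- homomorphism and every transposition is odd.
--
-- Ranking S_n by Fin (n!) shows that profiles with pairwise distinct components exist iff h ≤ n!.
-- Such a profile is moved by every (φ , id) with φ ≠ id, so when h ≤ n! a group V ≤_𝒫 A_h × {id}
-- cannot contain odd elements, while the constant profile forces V ⊆ S_h × {id}.  When n! < h,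
-- every profile has two equal components (pigeonhole), and composing an odd φ with their
-- transposition gives an even permutation with the same effect on that profile; hence
-- S_h × {id} ≤_𝒫 A_h × {id}, and it lies in every anonymity group containing A_h × {id}.
-- For h ≤ n! the SPF recording, as id or (0 1) ∈ S_n, the parity of the order in which pairwise
-- distinct preferences are listed has anonymity group exactly A_h × {id}.

module Submission where

open import Data.Bool.Base using (Bool; true; false; not; if_then_else_; _∧_)
open import Data.Empty using (⊥-elim)
open import Data.Fin.Base as Fin using (Fin; zero; suc; toℕ)
open import Data.Fin.Patterns using (0F; 1F)
open import Data.Fin.Permutation as Permutation using (Permutation′; _⟨$⟩ʳ_; _⟨$⟩ˡ_)
import Data.Fin.Permutation.Components as PC
open import Data.Fin.Properties
  using (toℕ-injective; _≟_; all?; <⇒≢; pigeonhole; inject≤-injective; punchIn-injective;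
         combine-injectiveˡ; combine-injectiveʳ; combine-remQuot)
open import Data.Nat.Base using (ℕ; zero; suc; _+_; _*_; _<ᵇ_; _!; _≤_; _<_; s≤s; z≤n; parity)
open import Data.Nat.Divisibility using (_∣_; divides)
import Data.Nat.Properties as ℕₚ
open import Algebra.Properties.Semiring.Sum ℕₚ.+-*-semiring
  using (sum; ∑-distrib-+; ∑-comm; ∑-permute; sum-cong-≗; *-distribˡ-sum)
open import Data.Parity.Base as ℙ using (Parity; 0ℙ; 1ℙ)
import Data.Parity.Properties as ℙₚ
open import Data.Product.Base using (_×_; _,_; proj₁; proj₂; ∃)
open import Data.Vec.Base as Vec using (Vec; lookup; tabulate)
open import Data.Vec.Properties using (lookup∘tabulate; tabulate∘lookup; tabulate-cong; lookup-replicate)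
open import Function.Base using (_∘_)
open import Function.Bundles using (_⇔_; mk⇔)
open import Function.Definitions using (Injective)
open import Level using (0ℓ)
open import Relation.Binary.Definitions using (tri<; tri≈; tri>)
open import Relation.Binary.PropositionalEquality
open import Relation.Nullary using (Dec; yes; no; contradiction)
open import Relation.Nullary.Decidable using (recompute; dec-true; dec-false; map′; _→-dec_)
open import Relation.Unary using (Pred; _⊆_; _≐_)

open import Defs

private variable k h n : ℕ

app⁻∘app : (σ : Perm k) (i : Fin k) → app⁻ σ (app σ i) ≡ i
app⁻∘app (mkPerm t f ft _) i = recompute (lookup f (lookup t i) ≟ i) (ft i)

app∘app⁻ : (σ : Perm k) (i : Fin k) → app σ (app⁻ σ i) ≡ i
app∘app⁻ (mkPerm t f _ tf) i = recompute (lookup t (lookup f i) ≟ i) (tf i)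

app-injective : (σ : Perm k) {i j : Fin k} → app σ i ≡ app σ j → i ≡ j
app-injective σ {i} {j} eq = begin
  i                    ≡⟨ app⁻∘app σ i ⟨
  app⁻ σ (app σ i)     ≡⟨ cong (app⁻ σ) eq ⟩
  app⁻ σ (app σ j)     ≡⟨ app⁻∘app σ j ⟩
  j                    ∎
  where open ≡-Reasoning

Vec-ext : {A : Set} {u v : Vec A k} → lookup u ≗ lookup v → u ≡ v
Vec-ext {u = u} {v} eq = trans (sym (tabulate∘lookup u)) (trans (tabulate-cong eq) (tabulate∘lookup v))

mkPerm-cong : {t t′ f f′ : Vec (Fin k) k}
  .{ft : ∀ i → lookup f (lookup t i) ≡ i} .{tf : ∀ i → lookup t (lookup f i) ≡ i}
  .{ft′ : ∀ i → lookup f′ (lookup t′ i) ≡ i} .{tf′ : ∀ i → lookup t′ (lookup f′ i) ≡ i} →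
  t ≡ t′ → f ≡ f′ → mkPerm t f ft tf ≡ mkPerm t′ f′ ft′ tf′
mkPerm-cong refl refl = refl

Perm-ext : {σ τ : Perm k} → app σ ≗ app τ → σ ≡ τ
Perm-ext {σ = σ@(mkPerm _ _ _ _)} {τ@(mkPerm _ _ _ _)} eq = mkPerm-cong (Vec-ext eq) (Vec-ext app⁻-eq)
  where
  app⁻-eq : app⁻ σ ≗ app⁻ τ
  app⁻-eq i = app-injective τ (trans (sym (eq (app⁻ σ i))) (trans (app∘app⁻ σ i) (sym (app∘app⁻ τ i))))

app-∘ : (σ τ : Perm k) (i : Fin k) → app (σ ∘ₚ τ) i ≡ app σ (app τ i)
app-∘ (mkPerm _ _ _ _) (mkPerm _ _ _ _) i = lookup∘tabulate _ i

app⁻-∘ : (σ τ : Perm k) (i : Fin k) → app⁻ (σ ∘ₚ τ) i ≡ app⁻ τ (app⁻ σ i)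
app⁻-∘ (mkPerm _ _ _ _) (mkPerm _ _ _ _) i = lookup∘tabulate _ i

app-idP : (i : Fin k) → app idP i ≡ i
app-idP i = lookup∘tabulate _ i

∘ₚ-identityˡ : (σ : Perm k) → idP ∘ₚ σ ≡ σ
∘ₚ-identityˡ σ = Perm-ext λ i → trans (app-∘ idP σ i) (app-idP _)

∘ₚ-identityʳ : (σ : Perm k) → σ ∘ₚ idP ≡ σ
∘ₚ-identityʳ σ = Perm-ext λ i → trans (app-∘ σ idP i) (cong (app σ) (app-idP i))

∘ₚ-inverseˡ : (σ : Perm k) → invP σ ∘ₚ σ ≡ idP
∘ₚ-inverseˡ σ = Perm-ext λ i → trans (app-∘ (invP σ) σ i) (trans (app⁻∘app σ i) (sym (app-idP i)))

toPermutation : Perm k → Permutation′ k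
toPermutation σ = Permutation.permutation (app σ) (app⁻ σ) (app∘app⁻ σ) (app⁻∘app σ)

fromPermutation : Permutation′ k → Perm k
fromPermutation π = mkPerm (tabulate (π ⟨$⟩ʳ_)) (tabulate (π ⟨$⟩ˡ_)) left-inverse right-inverse
  where
  left-inverse : ∀ i → lookup (tabulate (π ⟨$⟩ˡ_)) (lookup (tabulate (π ⟨$⟩ʳ_)) i) ≡ i
  left-inverse i rewrite lookup∘tabulate (π ⟨$⟩ʳ_) i | lookup∘tabulate (π ⟨$⟩ˡ_) (π ⟨$⟩ʳ i) = Permutation.inverseˡ π
  right-inverse : ∀ i → lookup (tabulate (π ⟨$⟩ʳ_)) (lookup (tabulate (π ⟨$⟩ˡ_)) i) ≡ i
  right-inverse i rewrite lookup∘tabulate (π ⟨$⟩ˡ_) i | lookup∘tabulate (π ⟨$⟩ʳ_) (π ⟨$⟩ˡ i) = Permutation.inverseʳ π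

app-fromPermutation : (π : Permutation′ k) (i : Fin k) → app (fromPermutation π) i ≡ π ⟨$⟩ʳ i
app-fromPermutation π i = lookup∘tabulate _ i

app⁻-fromPermutation : (π : Permutation′ k) (i : Fin k) → app⁻ (fromPermutation π) i ≡ π ⟨$⟩ˡ i
app⁻-fromPermutation π i = lookup∘tabulate _ i

transpose-left : (a b : Fin k) → PC.transpose a b a ≡ b
transpose-left a b rewrite dec-true (a ≟ a) refl = refl

transpose-right : (a b : Fin k) → PC.transpose a b b ≡ a
transpose-right a b with b ≟ a
... | yes b≡a = b≡a
... | no _ rewrite dec-true (b ≟ b) refl = refl

transpose-other : (a b : Fin k) {x : Fin k} → x ≢ a → x ≢ b → PC.transpose a b x ≡ x
transpose-other a b {x} x≢a x≢b rewrite dec-false (x ≟ a) x≢a | dec-false (x ≟ b) x≢b = refl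

transposition : Fin k → Fin k → Perm k
transposition a b = fromPermutation (Permutation.transpose a b)

app-transposition : (a b x : Fin k) → app (transposition a b) x ≡ PC.transpose a b x
app-transposition a b = app-fromPermutation (Permutation.transpose a b)

app⁻-transposition : (a b x : Fin k) → app⁻ (transposition a b) x ≡ PC.transpose b a x
app⁻-transposition a b = app⁻-fromPermutation (Permutation.transpose a b)

transpose-conjugate : (ρ : Perm k) (i j x : Fin k) →
  PC.transpose (app ρ i) (app ρ j) (app ρ x) ≡ app ρ (PC.transpose i j x)
transpose-conjugate ρ i j x = by-cases (x ≟ i) (x ≟ j)
  where
  by-cases : Dec (x ≡ i) → Dec (x ≡ j) →
    PC.transpose (app ρ i) (app ρ j) (app ρ x) ≡ app ρ (PC.transpose i j x)
  by-cases (yes refl) _ =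
    trans (transpose-left (app ρ i) (app ρ j)) (cong (app ρ) (sym (transpose-left i j)))
  by-cases (no _) (yes refl) =
    trans (transpose-right (app ρ i) (app ρ j)) (cong (app ρ) (sym (transpose-right i j)))
  by-cases (no x≢i) (no x≢j) = trans
    (transpose-other (app ρ i) (app ρ j) (x≢i ∘ app-injective ρ) (x≢j ∘ app-injective ρ))
    (cong (app ρ) (sym (transpose-other i j x≢i x≢j)))

transposition-conjugate : (ρ : Perm k) (i j : Fin k) →
  transposition (app ρ i) (app ρ j) ∘ₚ ρ ≡ ρ ∘ₚ transposition i j
transposition-conjugate ρ i j = Perm-ext λ x → begin
  app (transposition (app ρ i) (app ρ j) ∘ₚ ρ) x   ≡⟨ app-∘ (transposition (app ρ i) (app ρ j)) ρ x ⟩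
  app (transposition (app ρ i) (app ρ j)) (app ρ x) ≡⟨ app-transposition (app ρ i) (app ρ j) (app ρ x) ⟩
  PC.transpose (app ρ i) (app ρ j) (app ρ x)         ≡⟨ transpose-conjugate ρ i j x ⟩
  app ρ (PC.transpose i j x)                         ≡⟨ cong (app ρ) (app-transposition i j x) ⟨
  app ρ (app (transposition i j) x)                  ≡⟨ app-∘ ρ (transposition i j) x ⟨
  app (ρ ∘ₚ transposition i j) x                     ∎
  where open ≡-Reasoning

Perm-sending-01 : {a b : Fin (suc (suc k))} → a ≢ b →
  ∃ λ (ρ : Perm (suc (suc k))) → app ρ 0F ≡ a × app ρ 1F ≡ b
Perm-sending-01 {a = a} {b} a≢b = ρ , ρ0 , ρ1
  where
  b′ = PC.transpose a 0F b
  0≢b′ : 0F ≢ b′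
  0≢b′ 0≡b′ = a≢b (begin
    a                     ≡⟨ transpose-left 0F a ⟨
    PC.transpose 0F a 0F  ≡⟨ cong (PC.transpose 0F a) 0≡b′ ⟩
    PC.transpose 0F a b′  ≡⟨ PC.transpose-inverse 0F a ⟩
    b                     ∎)
    where open ≡-Reasoning
  ρ = transposition 0F a ∘ₚ transposition 1F b′
  app-ρ : ∀ x → app ρ x ≡ PC.transpose 0F a (PC.transpose 1F b′ x)
  app-ρ x = trans (app-∘ (transposition 0F a) (transposition 1F b′) x)
    (trans (app-transposition 0F a (app (transposition 1F b′) x))
           (cong (PC.transpose 0F a) (app-transposition 1F b′ x)))
  ρ0 : app ρ 0F ≡ a
  ρ0 = begin
    app ρ 0F                                  ≡⟨ app-ρ 0F ⟩
    PC.transpose 0F a (PC.transpose 1F b′ 0F) ≡⟨ cong (PC.transpose 0F a) (transpose-other 1F b′ (λ ()) 0≢b′) ⟩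
    PC.transpose 0F a 0F                      ≡⟨ transpose-left 0F a ⟩
    a                                         ∎
    where open ≡-Reasoning
  ρ1 : app ρ 1F ≡ b
  ρ1 = begin
    app ρ 1F                                  ≡⟨ app-ρ 1F ⟩
    PC.transpose 0F a (PC.transpose 1F b′ 1F) ≡⟨ cong (PC.transpose 0F a) (transpose-left 1F b′) ⟩
    PC.transpose 0F a b′                      ≡⟨ PC.transpose-inverse 0F a ⟩
    b                                         ∎
    where open ≡-Reasoning

-- Discordant pairs and the sign of a permutation

𝟙 : Bool → ℕ
𝟙 b = if b then 1 else 0

𝟙-∧ : (x y : Bool) → 𝟙 (x ∧ y) ≡ 𝟙 x * 𝟙 y
𝟙-∧ true  y = sym (ℕₚ.+-identityʳ (𝟙 y))
𝟙-∧ false y = refl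

<ᵇ-irrefl : (x : ℕ) → (x <ᵇ x) ≡ false
<ᵇ-irrefl x = dec-false (x ℕₚ.<? x) (ℕₚ.<-irrefl refl)

<ᵇ-flip : {x y : ℕ} → x ≢ y → (y <ᵇ x) ≡ not (x <ᵇ y)
<ᵇ-flip {x} {y} x≢y with ℕₚ.<-cmp x y
... | tri< x<y _ _ rewrite dec-true (x ℕₚ.<? y) x<y = dec-false (y ℕₚ.<? x) (ℕₚ.<⇒≯ x<y)
... | tri≈ _ x≡y _ = contradiction x≡y x≢y
... | tri> _ _ y<x rewrite dec-false (x ℕₚ.<? y) (ℕₚ.<⇒≯ y<x) = dec-true (y ℕₚ.<? x) y<x

∑∑ : ∀ {m} → (Fin m → Fin m → ℕ) → ℕ
∑∑ g = sum λ i → sum (g i)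

∑∑-cong : ∀ {m} {g g′ : Fin m → Fin m → ℕ} → (∀ i j → g i j ≡ g′ i j) → ∑∑ g ≡ ∑∑ g′
∑∑-cong eq = sum-cong-≗ λ i → sum-cong-≗ (eq i)

∑∑-distrib-+ : ∀ {m} (g g′ : Fin m → Fin m → ℕ) → ∑∑ (λ i j → g i j + g′ i j) ≡ ∑∑ g + ∑∑ g′
∑∑-distrib-+ g g′ = trans (sum-cong-≗ λ i → ∑-distrib-+ (g i) (g′ i))
                          (∑-distrib-+ (λ i → sum (g i)) (λ i → sum (g′ i)))

∑∑-distribˡ-* : ∀ {m} (c : ℕ) (g : Fin m → Fin m → ℕ) → ∑∑ (λ i j → c * g i j) ≡ c * ∑∑ g
∑∑-distribˡ-* c g = sym (trans (*-distribˡ-sum c (λ i → sum (g i)))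
                               (sum-cong-≗ λ i → *-distribˡ-sum c (g i)))

∑∑-symmetrise : ∀ {m} (g : Fin m → Fin m → ℕ) → ∑∑ (λ i j → g i j + g j i) ≡ 2 * ∑∑ g
∑∑-symmetrise g = begin
  ∑∑ (λ i j → g i j + g j i)     ≡⟨ ∑∑-distrib-+ g (λ i j → g j i) ⟩
  ∑∑ g + ∑∑ (λ i j → g j i)      ≡⟨ cong (∑∑ g +_) (∑-comm g) ⟨
  ∑∑ g + ∑∑ g                    ≡⟨ cong (∑∑ g +_) (ℕₚ.+-identityʳ (∑∑ g)) ⟨
  2 * ∑∑ g                       ∎
  where open ≡-Reasoning

discordantPairs : (Fin k → ℕ) → (Fin k → ℕ) → ℕ
discordantPairs a b = ∑∑ λ i j → 𝟙 (a i <ᵇ a j) * 𝟙 (b j <ᵇ b i)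

discordantPairs-congʳ : {a b b′ : Fin k → ℕ} → b ≗ b′ → discordantPairs a b ≡ discordantPairs a b′
discordantPairs-congʳ {a = a} b≗b′ =
  ∑∑-cong λ i j → cong₂ (λ x y → 𝟙 (a i <ᵇ a j) * 𝟙 (x <ᵇ y)) (b≗b′ j) (b≗b′ i)

discordantPairs-reindex : (a b : Fin k → ℕ) (τ : Perm k) →
  discordantPairs a b ≡ discordantPairs (a ∘ app τ) (b ∘ app τ)
discordantPairs-reindex a b τ = trans
  (∑-permute (λ i → sum (g i)) (toPermutation τ))
  (sum-cong-≗ λ i → ∑-permute (g (app τ i)) (toPermutation τ))
  where
  g = λ i j → 𝟙 (a i <ᵇ a j) * 𝟙 (b j <ᵇ b i)

-- With α, β, γ the orders of a pair under a, b, c: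
-- (α ⊕ β) + (β ⊕ γ) = (α ⊕ γ) + 2·[β differs from α and γ].
discordance-bits : (α β γ : Bool) →
  𝟙 α * 𝟙 (not β) + 𝟙 (not α) * 𝟙 β + (𝟙 β * 𝟙 (not γ) + 𝟙 (not β) * 𝟙 γ)
  ≡ 𝟙 α * 𝟙 (not γ) + 𝟙 (not α) * 𝟙 γ
    + 2 * (𝟙 α * 𝟙 (not β) * 𝟙 γ + 𝟙 (not α) * 𝟙 β * 𝟙 (not γ))
discordance-bits true  true  true  = refl
discordance-bits true  true  false = refl
discordance-bits true  false true  = refl
discordance-bits true  false false = refl
discordance-bits false true  true  = refl
discordance-bits false true  false = refl
discordance-bits false false true  = refl
discordance-bits false false false = refl

module _ {a b c : Fin k → ℕ}
         (a-inj : Injective _≡_ _≡_ a) (b-inj : Injective _≡_ _≡_ b) (c-inj : Injective _≡_ _≡_ c) where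

  private
    D : (Fin k → ℕ) → (Fin k → ℕ) → Fin k → Fin k → ℕ
    D x y i j = 𝟙 (x i <ᵇ x j) * 𝟙 (y j <ᵇ y i)

    S : (Fin k → ℕ) → (Fin k → ℕ) → Fin k → Fin k → ℕ
    S x y i j = D x y i j + D x y j i

    T : Fin k → Fin k → ℕ
    T i j = 𝟙 (a i <ᵇ a j) * 𝟙 (b j <ᵇ b i) * 𝟙 (c i <ᵇ c j)

    U : Fin k → Fin k → ℕ
    U i j = T i j + T j i

    pairwise : ∀ i j → S a b i j + S b c i j ≡ S a c i j + 2 * U i j
    pairwise i j with i ≟ j
    ... | yes refl rewrite <ᵇ-irrefl (a i) | <ᵇ-irrefl (b i) = refl
    ... | no i≢j
      rewrite <ᵇ-flip {a i} {a j} (i≢j ∘ a-inj)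
            | <ᵇ-flip {b i} {b j} (i≢j ∘ b-inj)
            | <ᵇ-flip {c i} {c j} (i≢j ∘ c-inj)
      = discordance-bits (a i <ᵇ a j) (b i <ᵇ b j) (c i <ᵇ c j)

  discordantPairs-triangle :
    ∃ λ K → discordantPairs a b + discordantPairs b c ≡ discordantPairs a c + 2 * K
  discordantPairs-triangle = ∑∑ T , ℕₚ.*-cancelˡ-≡ _ _ 2 (begin
    2 * (discordantPairs a b + discordantPairs b c)
      ≡⟨ ℕₚ.*-distribˡ-+ 2 (discordantPairs a b) _ ⟩
    2 * discordantPairs a b + 2 * discordantPairs b c
      ≡⟨ cong₂ _+_ (∑∑-symmetrise (D a b)) (∑∑-symmetrise (D b c)) ⟨
    ∑∑ (S a b) + ∑∑ (S b c)
      ≡⟨ ∑∑-distrib-+ (S a b) (S b c) ⟨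
    ∑∑ (λ i j → S a b i j + S b c i j)
      ≡⟨ ∑∑-cong pairwise ⟩
    ∑∑ (λ i j → S a c i j + 2 * U i j)
      ≡⟨ ∑∑-distrib-+ (S a c) (λ i j → 2 * U i j) ⟩
    ∑∑ (S a c) + ∑∑ (λ i j → 2 * U i j)
      ≡⟨ cong₂ _+_ (∑∑-symmetrise (D a c)) (∑∑-distribˡ-* 2 U) ⟩
    2 * discordantPairs a c + 2 * ∑∑ U
      ≡⟨ cong (λ z → 2 * discordantPairs a c + 2 * z) (∑∑-symmetrise T) ⟩
    2 * discordantPairs a c + 2 * (2 * ∑∑ T)
      ≡⟨ ℕₚ.*-distribˡ-+ 2 (discordantPairs a c) _ ⟨
    2 * (discordantPairs a c + 2 * ∑∑ T)
      ∎)
    where open ≡-Reasoning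

parity-2* : (m : ℕ) → parity (2 * m) ≡ 0ℙ
parity-2* m = ℙₚ.*-homo-* 2 m

2∣⇒parity≡0ℙ : {m : ℕ} → 2 ∣ m → parity m ≡ 0ℙ
2∣⇒parity≡0ℙ (divides q refl) = trans (cong parity (ℕₚ.*-comm q 2)) (parity-2* q)

parity≡0ℙ⇒2∣ : (m : ℕ) → parity m ≡ 0ℙ → 2 ∣ m
parity≡0ℙ⇒2∣ zero          _  = divides 0 refl
parity≡0ℙ⇒2∣ (suc (suc m)) eq with divides q m≡q*2 ← parity≡0ℙ⇒2∣ m eq =
  divides (suc q) (cong (2 +_) m≡q*2)

discordantPairs-parity-triangle : {a b c : Fin k → ℕ} →
  Injective _≡_ _≡_ a → Injective _≡_ _≡_ b → Injective _≡_ _≡_ c →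
  parity (discordantPairs a b) ℙ.+ parity (discordantPairs b c) ≡ parity (discordantPairs a c)
discordantPairs-parity-triangle {a = a} {b} {c} a-inj b-inj c-inj
  with K , triangle ← discordantPairs-triangle a-inj b-inj c-inj = begin
  parity (discordantPairs a b) ℙ.+ parity (discordantPairs b c) ≡⟨ ℙₚ.+-homo-+ (discordantPairs a b) _ ⟨
  parity (discordantPairs a b + discordantPairs b c)            ≡⟨ cong parity triangle ⟩
  parity (discordantPairs a c + 2 * K)                          ≡⟨ ℙₚ.+-homo-+ (discordantPairs a c) (2 * K) ⟩
  parity (discordantPairs a c) ℙ.+ parity (2 * K)               ≡⟨ cong (parity (discordantPairs a c) ℙ.+_) (parity-2* K) ⟩
  parity (discordantPairs a c) ℙ.+ 0ℙ                           ≡⟨ ℙₚ.+-identityʳ _ ⟩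
  parity (discordantPairs a c)                                  ∎
  where open ≡-Reasoning

sum-tabulate : ∀ {m} (f : Fin m → ℕ) → Vec.sum (tabulate f) ≡ sum f
sum-tabulate {zero}  f = refl
sum-tabulate {suc m} f = cong (f zero +_) (sum-tabulate (f ∘ suc))

inversions≡discordantPairs : (σ : Perm k) → inversions σ ≡ discordantPairs toℕ (toℕ ∘ app σ)
inversions≡discordantPairs σ =
  trans (sum-tabulate (λ i → Vec.sum (tabulate (inversionAt i))))
        (sum-cong-≗ λ i → trans (sum-tabulate (inversionAt i)) (sum-cong-≗ λ j →
          𝟙-∧ (toℕ i <ᵇ toℕ j) (toℕ (app σ j) <ᵇ toℕ (app σ i))))
  where
  inversionAt : Fin _ → Fin _ → ℕ
  inversionAt i j = 𝟙 ((toℕ i <ᵇ toℕ j) ∧ (toℕ (app σ j) <ᵇ toℕ (app σ i)))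

sign : Perm k → Parity
sign σ = parity (inversions σ)

IsEven⇒sign≡0ℙ : (σ : Perm k) → IsEven σ → sign σ ≡ 0ℙ
IsEven⇒sign≡0ℙ σ = 2∣⇒parity≡0ℙ

sign≡0ℙ⇒IsEven : (σ : Perm k) → sign σ ≡ 0ℙ → IsEven σ
sign≡0ℙ⇒IsEven σ = parity≡0ℙ⇒2∣ (inversions σ)

inversionParity : (Fin k → ℕ) → Parity
inversionParity f = parity (discordantPairs toℕ f)

sign≡inversionParity : (σ : Perm k) → sign σ ≡ inversionParity (toℕ ∘ app σ)
sign≡inversionParity σ = cong parity (inversions≡discordantPairs σ)

inversionParity-cong : {f g : Fin k → ℕ} → f ≗ g → inversionParity f ≡ inversionParity g
inversionParity-cong eq = cong parity (discordantPairs-congʳ {a = toℕ} eq)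

inversionParity-∘ : {f : Fin k → ℕ} → Injective _≡_ _≡_ f → (τ : Perm k) →
  inversionParity (f ∘ app τ) ≡ inversionParity f ℙ.+ sign τ
inversionParity-∘ {f = f} f-inj τ = begin
  inversionParity (f ∘ app τ)
    ≡⟨ discordantPairs-parity-triangle toℕ-injective toℕ∘τ-inj f∘τ-inj ⟨
  inversionParity (toℕ ∘ app τ) ℙ.+ parity (discordantPairs (toℕ ∘ app τ) (f ∘ app τ))
    ≡⟨ cong₂ ℙ._+_ (sign≡inversionParity τ) (cong parity (discordantPairs-reindex toℕ f τ)) ⟨
  sign τ ℙ.+ inversionParity f
    ≡⟨ ℙₚ.+-comm (sign τ) _ ⟩
  inversionParity f ℙ.+ sign τ
    ∎
  where
  open ≡-Reasoning
  toℕ∘τ-inj : Injective _≡_ _≡_ (toℕ ∘ app τ)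
  toℕ∘τ-inj = app-injective τ ∘ toℕ-injective
  f∘τ-inj : Injective _≡_ _≡_ (f ∘ app τ)
  f∘τ-inj = app-injective τ ∘ f-inj

sign-∘ : (σ τ : Perm k) → sign (σ ∘ₚ τ) ≡ sign σ ℙ.+ sign τ
sign-∘ σ τ = begin
  sign (σ ∘ₚ τ)                            ≡⟨ sign≡inversionParity (σ ∘ₚ τ) ⟩
  inversionParity (toℕ ∘ app (σ ∘ₚ τ))     ≡⟨ inversionParity-cong (cong toℕ ∘ app-∘ σ τ) ⟩
  inversionParity (toℕ ∘ app σ ∘ app τ)    ≡⟨ inversionParity-∘ (app-injective σ ∘ toℕ-injective) τ ⟩
  inversionParity (toℕ ∘ app σ) ℙ.+ sign τ ≡⟨ cong (ℙ._+ sign τ) (sign≡inversionParity σ) ⟨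
  sign σ ℙ.+ sign τ                        ∎
  where open ≡-Reasoning

sign-idP : sign (idP {k}) ≡ 0ℙ
sign-idP {k} = trans (cong sign (sym (∘ₚ-identityˡ (idP {k}))))
                     (trans (sign-∘ (idP {k}) idP) (ℙₚ.p+p≡0ℙ (sign (idP {k}))))

sign-invP : (σ : Perm k) → sign (invP σ) ≡ sign σ
sign-invP {k} σ = ℙₚ.+-cancelʳ-≡ (sign σ) (sign (invP σ)) (sign σ) (begin
  sign (invP σ) ℙ.+ sign σ    ≡⟨ sign-∘ (invP σ) σ ⟨
  sign (invP σ ∘ₚ σ)          ≡⟨ cong sign (∘ₚ-inverseˡ σ) ⟩
  sign (idP {k})              ≡⟨ sign-idP {k} ⟩
  0ℙ                          ≡⟨ ℙₚ.p+p≡0ℙ (sign σ) ⟨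
  sign σ ℙ.+ sign σ           ∎)
  where open ≡-Reasoning

𝟙<ᵇ-asym : (x y : ℕ) → 𝟙 (x <ᵇ y) * 𝟙 (y <ᵇ x) ≡ 0
𝟙<ᵇ-asym x y with x ℕₚ.≟ y
... | yes refl rewrite <ᵇ-irrefl x = refl
... | no x≢y rewrite <ᵇ-flip x≢y with x <ᵇ y
...   | true  = refl
...   | false = refl

sum-zero : ∀ m → sum {m} (λ _ → 0) ≡ 0
sum-zero zero    = refl
sum-zero (suc m) = sum-zero m

transposition01 : Perm (suc (suc k))
transposition01 = transposition 0F 1F

inversions-transposition01 : inversions (transposition01 {k}) ≡ 1
inversions-transposition01 {k} = begin
  inversions (transposition01 {k})
    ≡⟨ inversions≡discordantPairs (transposition01 {k}) ⟩
  discordantPairs toℕ (toℕ ∘ app (transposition01 {k}))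
    ≡⟨ discordantPairs-congʳ {a = toℕ} (λ i → cong toℕ (app-transposition {suc (suc k)} 0F 1F i)) ⟩
  discordantPairs toℕ (toℕ ∘ swap01)
    ≡⟨ sum-cong-≗ row ⟩
  sum δ₀
    ≡⟨ cong suc (sum-zero (suc k)) ⟩
  1 ∎
  where
  open ≡-Reasoning
  swap01 : Fin (suc (suc k)) → Fin (suc (suc k))
  swap01 = PC.transpose 0F 1F
  δ₀ : Fin (suc (suc k)) → ℕ
  δ₀ 0F = 1
  δ₀ (suc _) = 0
  row : ∀ i → sum (λ j → 𝟙 (toℕ i <ᵇ toℕ j) * 𝟙 (toℕ (swap01 j) <ᵇ toℕ (swap01 i))) ≡ δ₀ i
  row 0F = cong suc (sum-zero k)
  row 1F = sum-zero k
  row (suc (suc x)) = trans (sum-cong-≗ {k} λ y → 𝟙<ᵇ-asym (toℕ x) (toℕ y)) (sum-zero k)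

sign-transposition01 : sign (transposition01 {k}) ≡ 1ℙ
sign-transposition01 {k} = cong parity (inversions-transposition01 {k})

sign-transposition : {a b : Fin (suc (suc k))} → a ≢ b → sign (transposition a b) ≡ 1ℙ
sign-transposition {k} a≢b with ρ , refl , refl ← Perm-sending-01 a≢b =
  ℙₚ.+-cancelʳ-≡ (sign ρ) (sign (transposition (app ρ 0F) (app ρ 1F))) 1ℙ (begin
    sign (transposition (app ρ 0F) (app ρ 1F)) ℙ.+ sign ρ ≡⟨ sign-∘ (transposition (app ρ 0F) (app ρ 1F)) ρ ⟨
    sign (transposition (app ρ 0F) (app ρ 1F) ∘ₚ ρ)       ≡⟨ cong sign (transposition-conjugate ρ 0F 1F) ⟩
    sign (ρ ∘ₚ transposition01)                           ≡⟨ sign-∘ ρ transposition01 ⟩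
    sign ρ ℙ.+ sign (transposition01 {k})                 ≡⟨ cong (sign ρ ℙ.+_) (sign-transposition01 {k}) ⟩
    sign ρ ℙ.+ 1ℙ                                         ≡⟨ ℙₚ.+-comm (sign ρ) 1ℙ ⟩
    1ℙ ℙ.+ sign ρ                                         ∎)
  where open ≡-Reasoning

-- Ranking permutations

rankPermutation : ∀ {n} → Permutation′ n → Fin (n !)
rankPermutation {zero}  π = zero
rankPermutation {suc n} π = Fin.combine (π ⟨$⟩ʳ 0F) (rankPermutation (Permutation.remove 0F π))

rankPermutation-injective : ∀ {n} (π ρ : Permutation′ n) →
  rankPermutation π ≡ rankPermutation ρ → π Permutation.≈ ρ
rankPermutation-injective {suc n} π ρ eq zero = combine-injectiveˡ (π ⟨$⟩ʳ 0F) _ (ρ ⟨$⟩ʳ 0F) _ eq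
rankPermutation-injective {suc n} π ρ eq (suc j) = begin
  π ⟨$⟩ʳ suc j
    ≡⟨ Permutation.punchIn-permute π 0F j ⟩
  Fin.punchIn (π ⟨$⟩ʳ 0F) (Permutation.remove 0F π ⟨$⟩ʳ j)
    ≡⟨ cong₂ Fin.punchIn π0≡ρ0 (rankPermutation-injective _ _ rest≡ j) ⟩
  Fin.punchIn (ρ ⟨$⟩ʳ 0F) (Permutation.remove 0F ρ ⟨$⟩ʳ j)
    ≡⟨ Permutation.punchIn-permute ρ 0F j ⟨
  ρ ⟨$⟩ʳ suc j
    ∎
  where
  open ≡-Reasoning
  π0≡ρ0 = combine-injectiveˡ (π ⟨$⟩ʳ 0F) _ (ρ ⟨$⟩ʳ 0F) _ eq
  rest≡ = combine-injectiveʳ (π ⟨$⟩ʳ 0F) _ (ρ ⟨$⟩ʳ 0F) _ eq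

unrankPermutation : ∀ {n} → Fin (n !) → Permutation′ n
unrankPermutation {zero}  _ = Permutation.id
unrankPermutation {suc n} x = Permutation.insert 0F i (unrankPermutation y)
  where
  i = proj₁ (Fin.remQuot {suc n} (n !) x)
  y = proj₂ (Fin.remQuot {suc n} (n !) x)

unrankPermutation-injective : ∀ {n} (x y : Fin (n !)) →
  unrankPermutation {n} x Permutation.≈ unrankPermutation y → x ≡ y
unrankPermutation-injective {zero}  zero zero _ = refl
unrankPermutation-injective {suc n} x y eq = begin
  x                                  ≡⟨ combine-remQuot {suc n} (n !) x ⟨
  Fin.combine (proj₁ qx) (proj₂ qx)  ≡⟨ cong₂ Fin.combine q₁≡ q₂≡ ⟩
  Fin.combine (proj₁ qy) (proj₂ qy)  ≡⟨ combine-remQuot {suc n} (n !) y ⟩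
  y                                  ∎
  where
  open ≡-Reasoning
  qx = Fin.remQuot {suc n} (n !) x
  qy = Fin.remQuot {suc n} (n !) y
  q₁≡ : proj₁ qx ≡ proj₁ qy
  q₁≡ = eq 0F
  q₂≡ : proj₂ qx ≡ proj₂ qy
  q₂≡ = unrankPermutation-injective (proj₂ qx) (proj₂ qy) λ j →
    let πx = unrankPermutation (proj₂ qx) ⟨$⟩ʳ j
        πy = unrankPermutation (proj₂ qy) ⟨$⟩ʳ j
    in punchIn-injective (proj₁ qx) πx πy (trans (eq (suc j)) (cong (λ i → Fin.punchIn i πy) (sym q₁≡)))

-- Opaque: unfolding `rank` would let the conversion checker normalise factorials.
opaque
  rank : ∀ {n} → Perm n → Fin (n !)
  rank σ = rankPermutation (toPermutation σ)

  rank-injective : ∀ {n} → Injective _≡_ _≡_ (rank {n})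
  rank-injective {x = σ} {τ} eq = Perm-ext (rankPermutation-injective (toPermutation σ) (toPermutation τ) eq)

  unrank : ∀ {n} → Fin (n !) → Perm n
  unrank x = fromPermutation (unrankPermutation x)

  unrank-injective : ∀ {n} → Injective _≡_ _≡_ (unrank {n})
  unrank-injective {x = x} {y} eq = unrankPermutation-injective x y λ i → begin
    unrankPermutation x ⟨$⟩ʳ i    ≡⟨ app-fromPermutation (unrankPermutation x) i ⟨
    app (unrank x) i              ≡⟨ cong (λ σ → app σ i) eq ⟩
    app (unrank y) i              ≡⟨ app-fromPermutation (unrankPermutation y) i ⟩
    unrankPermutation y ⟨$⟩ʳ i    ∎
    where open ≡-Reasoning

profile-pigeonhole : n ! < h → (p : Profile h n) → ∃ λ a → ∃ λ b → a ≢ b × lookup p a ≡ lookup p b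
profile-pigeonhole n!<h p with a , b , a<b , eq ← pigeonhole n!<h (rank ∘ lookup p) =
  a , b , <⇒≢ a<b , rank-injective eq

injectiveProfile : h ≤ n ! → Profile h n
injectiveProfile h≤n! = tabulate λ i → unrank (Fin.inject≤ i h≤n!)

injectiveProfile-injective : (h≤n! : h ≤ n !) → Injective _≡_ _≡_ (lookup (injectiveProfile {h} {n} h≤n!))
injectiveProfile-injective {h} {n} h≤n! {i} {j} eq = inject≤-injective h≤n! h≤n! i j (unrank-injective (begin
  unrank (Fin.inject≤ i h≤n!)         ≡⟨ lookup∘tabulate (λ x → unrank {n} (Fin.inject≤ x h≤n!)) i ⟨
  lookup (injectiveProfile h≤n!) i    ≡⟨ eq ⟩
  lookup (injectiveProfile h≤n!) j    ≡⟨ lookup∘tabulate (λ x → unrank {n} (Fin.inject≤ x h≤n!)) j ⟩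
  unrank (Fin.inject≤ j h≤n!)         ∎))
  where open ≡-Reasoning

lookup-act : (p : Profile h n) (φ : Perm h) (ψ : Perm n) (i : Fin h) →
  lookup (act p (φ , ψ)) i ≡ ψ ∘ₚ lookup p (app⁻ φ i)
lookup-act p φ ψ i = lookup∘tabulate _ i

lookup-act-idP : (p : Profile h n) (φ : Perm h) (i : Fin h) → lookup (act p (φ , idP)) i ≡ lookup p (app⁻ φ i)
lookup-act-idP p φ i = trans (lookup-act p φ idP i) (∘ₚ-identityˡ _)

act-idP-injective : (p : Profile h n) → Injective _≡_ _≡_ (lookup p) →
  {φ φ′ : Perm h} → act p (φ , idP) ≡ act p (φ′ , idP) → φ ≡ φ′
act-idP-injective p p-inj {φ} {φ′} eq = cong invP (Perm-ext {σ = invP φ} {invP φ′} λ i → p-inj (begin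
  lookup p (app⁻ φ i)             ≡⟨ lookup-act-idP p φ i ⟨
  lookup (act p (φ , idP)) i      ≡⟨ cong (λ q → lookup q i) eq ⟩
  lookup (act p (φ′ , idP)) i     ≡⟨ lookup-act-idP p φ′ i ⟩
  lookup p (app⁻ φ′ i)            ∎))
  where open ≡-Reasoning

lookup-act-replicate : (φ : Perm h) (ψ : Perm n) (i : Fin h) → lookup (act (Vec.replicate h idP) (φ , ψ)) i ≡ ψ
lookup-act-replicate φ ψ i = trans (lookup-act (Vec.replicate _ idP) φ ψ i)
  (trans (cong (ψ ∘ₚ_) (lookup-replicate (app⁻ φ i) idP)) (∘ₚ-identityʳ ψ))

∘-transpose-≗ : {A : Set} (f : Fin k → A) {a b : Fin k} → f a ≡ f b → f ∘ PC.transpose a b ≗ f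
∘-transpose-≗ f {a} {b} fa≡fb x = by-cases (x ≟ a) (x ≟ b)
  where
  by-cases : Dec (x ≡ a) → Dec (x ≡ b) → f (PC.transpose a b x) ≡ f x
  by-cases (yes refl) _          = trans (cong f (transpose-left a b)) (sym fa≡fb)
  by-cases (no _)     (yes refl) = trans (cong f (transpose-right a b)) fa≡fb
  by-cases (no x≢a)   (no x≢b)   = cong f (transpose-other a b x≢a x≢b)

act-∘-transposition : (p : Profile h n) {a b : Fin h} → lookup p a ≡ lookup p b →
  (φ : Perm h) (ψ : Perm n) → act p (φ ∘ₚ transposition a b , ψ) ≡ act p (φ , ψ)
act-∘-transposition p {a} {b} pa≡pb φ ψ = Vec-ext λ i → begin
  lookup (act p (φ ∘ₚ transposition a b , ψ)) i
    ≡⟨ lookup-act p (φ ∘ₚ transposition a b) ψ i ⟩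
  ψ ∘ₚ lookup p (app⁻ (φ ∘ₚ transposition a b) i)
    ≡⟨ cong (λ x → ψ ∘ₚ lookup p x) (app⁻-∘ φ (transposition a b) i) ⟩
  ψ ∘ₚ lookup p (app⁻ (transposition a b) (app⁻ φ i))
    ≡⟨ cong (λ x → ψ ∘ₚ lookup p x) (app⁻-transposition a b (app⁻ φ i)) ⟩
  ψ ∘ₚ lookup p (PC.transpose b a (app⁻ φ i))
    ≡⟨ cong (ψ ∘ₚ_) (∘-transpose-≗ (lookup p) (sym pa≡pb) (app⁻ φ i)) ⟩
  ψ ∘ₚ lookup p (app⁻ φ i)
    ≡⟨ lookup-act p φ ψ i ⟨
  lookup (act p (φ , ψ)) i
    ∎
  where open ≡-Reasoning

⟨⟩-least : {𝒮 : Pred (Subset h n) 0ℓ} {W : Subset h n} → IsSubgroup W →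
  (∀ {V} → 𝒮 V → V ⊆ W) → ⟨ 𝒮 ⟩ ⊆ W
⟨⟩-least W-sub 𝒮⊆W (gen V∈𝒮 g∈V) = 𝒮⊆W V∈𝒮 g∈V
⟨⟩-least W-sub 𝒮⊆W one           = has-e
  where open IsSubgroup W-sub
⟨⟩-least W-sub 𝒮⊆W (mul a∈ b∈)   = closed· (⟨⟩-least W-sub 𝒮⊆W a∈) (⟨⟩-least W-sub 𝒮⊆W b∈)
  where open IsSubgroup W-sub
⟨⟩-least W-sub 𝒮⊆W (inv a∈)      = closed⁻ (⟨⟩-least W-sub 𝒮⊆W a∈)
  where open IsSubgroup W-sub

AhId-isSubgroup : IsSubgroup (AhId h n)
AhId-isSubgroup {h} = record
  { has-e   = sign≡0ℙ⇒IsEven (idP {h}) (sign-idP {h}) , refl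
  ; closed· = λ { {φ , _} {φ′ , _} (φ-even , refl) (φ′-even , refl) → even-∘ φ φ′ φ-even φ′-even , ∘ₚ-identityˡ idP }
  ; closed⁻ = λ { {φ , _} (φ-even , refl) → even-invP φ φ-even , refl }
  }
  where
  even-∘ : (φ φ′ : Perm h) → IsEven φ → IsEven φ′ → IsEven (φ ∘ₚ φ′)
  even-∘ φ φ′ φ-even φ′-even = sign≡0ℙ⇒IsEven (φ ∘ₚ φ′)
    (trans (sign-∘ φ φ′) (cong₂ ℙ._+_ (IsEven⇒sign≡0ℙ φ φ-even) (IsEven⇒sign≡0ℙ φ′ φ′-even)))
  even-invP : (φ : Perm h) → IsEven φ → IsEven (invP φ)
  even-invP φ φ-even = sign≡0ℙ⇒IsEven (invP φ) (trans (sign-invP φ) (IsEven⇒sign≡0ℙ φ φ-even))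

ShId-isSubgroup : IsSubgroup (ShId h n)
ShId-isSubgroup = record
  { has-e   = refl
  ; closed· = λ { refl refl → ∘ₚ-identityˡ idP }
  ; closed⁻ = λ { refl → refl }
  }

⊆ShId⇒Regular : {V : Subset h n} → V ⊆ ShId h n → Regular V
⊆ShId⇒Regular V⊆ShId p u u∈V _ = V⊆ShId u∈V

-- Comparing the constant profile (id, …, id) with its images reads off the S_n component.
≤𝒫-⊆-ShId : {U V : Subset (suc h) n} → U ⊆ ShId (suc h) n → V ≤𝒫 U → V ⊆ ShId (suc h) n
≤𝒫-⊆-ShId {h} {n} U⊆ShId V≤U {φ , ψ} g∈V
  with (φ′ , ψ′) , u∈U , eq ← V≤U (Vec.replicate (suc h) idP) (φ , ψ) g∈V = begin
  ψ                                                     ≡⟨ lookup-act-replicate φ ψ 0F ⟨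
  lookup (act (Vec.replicate (suc h) idP) (φ , ψ)) 0F   ≡⟨ cong (λ q → lookup q 0F) eq ⟨
  lookup (act (Vec.replicate (suc h) idP) (φ′ , ψ′)) 0F ≡⟨ lookup-act-replicate φ′ ψ′ 0F ⟩
  ψ′                                                    ≡⟨ U⊆ShId u∈U ⟩
  idP                                                   ∎
  where open ≡-Reasoning

-- An injective profile separates the elements of S_h × {id}.
≤𝒫-⊆ : {U V : Subset h n} → h ≤ n ! → U ⊆ ShId h n → V ⊆ ShId h n → V ≤𝒫 U → V ⊆ U
≤𝒫-⊆ {h} {n} {U} h≤n! U⊆ShId V⊆ShId V≤U {φ , ψ} g∈V
  with refl ← V⊆ShId g∈V
  with (φ′ , ψ′) , u∈U , eq ← V≤U (injectiveProfile h≤n!) (φ , idP) g∈V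
  with refl ← U⊆ShId u∈U
  = subst (λ χ → U (χ , idP)) (act-idP-injective q (injectiveProfile-injective h≤n!) eq) u∈U
  where q = injectiveProfile h≤n!

ShId-≤𝒫-AhId : ∀ {h n} → n ! < suc (suc h) → ShId (suc (suc h)) n ≤𝒫 AhId (suc (suc h)) n
ShId-≤𝒫-AhId n!<h p (φ , _) refl with sign φ in sign-φ
... | 0ℙ = (φ , idP) , (sign≡0ℙ⇒IsEven φ sign-φ , refl) , refl
... | 1ℙ with a , b , a≢b , pa≡pb ← profile-pigeonhole n!<h p =
  (φ ∘ₚ transposition a b , idP) ,
  (sign≡0ℙ⇒IsEven (φ ∘ₚ transposition a b) even , refl) ,
  act-∘-transposition p pa≡pb φ idP
  where
  even : sign (φ ∘ₚ transposition a b) ≡ 0ℙ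
  even = trans (sign-∘ φ (transposition a b)) (cong₂ ℙ._+_ sign-φ (sign-transposition a≢b))

≤𝒫-⊆-G₁ : {F : SPF h n} {V : Subset h n} → V ⊆ ShId h n → V ≤𝒫 G₁ F → V ⊆ G₁ F
≤𝒫-⊆-G₁ {F = F} V⊆ShId V≤G₁ {φ , _} g∈V with refl ← V⊆ShId g∈V = refl , F-invariant
  where
  F-invariant : ∀ p → F (act p (φ , idP)) ≡ F p
  F-invariant p with (φ′ , _) , (refl , F-invariant′) , eq ← V≤G₁ p (φ , idP) g∈V =
    trans (cong F (sym eq)) (F-invariant′ p)

AhId∈𝒜 : 𝒜 (AhId h n) (AhId h n)
AhId∈𝒜 {h} {n} =
  AhId-isSubgroup , ⊆ShId⇒Regular {V = AhId h n} proj₂ , (λ g∈ → g∈) , (λ p v v∈ → v , v∈ , refl)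

O-AhId≐AhId : suc h ≤ n ! → O (AhId (suc h) n) ≐ AhId (suc h) n
O-AhId≐AhId {h} {n} h≤n! =
  ⟨⟩-least AhId-isSubgroup (λ (_ , _ , _ , V≤U) →
    ≤𝒫-⊆ {U = AhId (suc h) n} h≤n! proj₂ (≤𝒫-⊆-ShId {U = AhId (suc h) n} proj₂ V≤U) V≤U) ,
  gen AhId∈𝒜

O-AhId≐ShId : ∀ {h n} → n ! < suc (suc h) → O (AhId (suc (suc h)) n) ≐ ShId (suc (suc h)) n
O-AhId≐ShId {h} {n} n!<h =
  ⟨⟩-least ShId-isSubgroup (λ (_ , _ , _ , V≤U) → ≤𝒫-⊆-ShId {U = AhId (suc (suc h)) n} proj₂ V≤U) ,
  gen (ShId-isSubgroup , ⊆ShId⇒Regular {V = ShId (suc (suc h)) n} (λ g∈ → g∈) , proj₂ ,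
       ShId-≤𝒫-AhId {n = n} n!<h)

-- An SPF whose anonymity group is A_h × {id}

injective? : (f : Fin k → ℕ) → Dec (Injective _≡_ _≡_ f)
injective? f = map′ (λ inj {i} {j} → inj i j) (λ inj i j → inj)
  (all? λ i → all? λ j → (f i ℕₚ.≟ f j) →-dec (i ≟ j))

-- Set to 0ℙ off the injective functions, so that it is invariant under every even reordering.
orderParity : (Fin k → ℕ) → Parity
orderParity f with injective? f
... | yes _ = inversionParity f
... | no _  = 0ℙ

∘-app-injective : {f : Fin k → ℕ} (τ : Perm k) → Injective _≡_ _≡_ f → Injective _≡_ _≡_ (f ∘ app τ)
∘-app-injective τ f-inj = app-injective τ ∘ f-inj

∘-app-injective⁻ : {f : Fin k → ℕ} (τ : Perm k) → Injective _≡_ _≡_ (f ∘ app τ) → Injective _≡_ _≡_ f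
∘-app-injective⁻ {f = f} τ fτ-inj {i} {j} eq = begin
  i                     ≡⟨ app∘app⁻ τ i ⟨
  app τ (app⁻ τ i)      ≡⟨ cong (app τ) (fτ-inj f-eq) ⟩
  app τ (app⁻ τ j)      ≡⟨ app∘app⁻ τ j ⟩
  j                     ∎
  where
  open ≡-Reasoning
  f-eq : f (app τ (app⁻ τ i)) ≡ f (app τ (app⁻ τ j))
  f-eq = trans (cong f (app∘app⁻ τ i)) (trans eq (sym (cong f (app∘app⁻ τ j))))

orderParity-cong : {f g : Fin k → ℕ} → f ≗ g → orderParity f ≡ orderParity g
orderParity-cong {f = f} {g} f≗g with injective? f | injective? g
... | yes _     | yes _     = inversionParity-cong f≗g
... | yes f-inj | no ¬g-inj = ⊥-elim (¬g-inj λ eq → f-inj (trans (f≗g _) (trans eq (sym (f≗g _)))))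
... | no ¬f-inj | yes g-inj = ⊥-elim (¬f-inj λ eq → g-inj (trans (sym (f≗g _)) (trans eq (f≗g _))))
... | no _      | no _      = refl

orderParity-∘ : {f : Fin k → ℕ} → Injective _≡_ _≡_ f → (τ : Perm k) →
  orderParity (f ∘ app τ) ≡ orderParity f ℙ.+ sign τ
orderParity-∘ {f = f} f-inj τ with injective? f | injective? (f ∘ app τ)
... | yes _ | yes _      = inversionParity-∘ f-inj τ
... | no ¬f-inj | _      = ⊥-elim (¬f-inj f-inj)
... | yes _ | no ¬fτ-inj = ⊥-elim (¬fτ-inj (∘-app-injective τ f-inj))

orderParity-∘-even : (f : Fin k → ℕ) (τ : Perm k) → sign τ ≡ 0ℙ →
  orderParity (f ∘ app τ) ≡ orderParity f
orderParity-∘-even f τ τ-even with injective? f | injective? (f ∘ app τ)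
... | yes f-inj | yes _      =
  trans (inversionParity-∘ f-inj τ) (trans (cong (inversionParity f ℙ.+_) τ-even) (ℙₚ.+-identityʳ _))
... | yes f-inj | no ¬fτ-inj = ⊥-elim (¬fτ-inj (∘-app-injective τ f-inj))
... | no ¬f-inj | yes fτ-inj = ⊥-elim (¬f-inj (∘-app-injective⁻ τ fτ-inj))
... | no _      | no _       = refl

parityPerm : Parity → Perm (suc (suc k))
parityPerm 0ℙ = idP
parityPerm 1ℙ = transposition01

idP≢transposition01 : idP ≢ transposition01 {k}
idP≢transposition01 {k} eq = 0F≢1F (begin
  0F                              ≡⟨ app-idP 0F ⟨
  app idP 0F                      ≡⟨ cong (λ σ → app σ 0F) eq ⟩
  app (transposition01 {k}) 0F    ≡⟨ app-transposition 0F 1F 0F ⟩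
  1F                              ∎)
  where
  open ≡-Reasoning
  0F≢1F : 0F ≢ 1F
  0F≢1F ()

parityPerm-injective : Injective _≡_ _≡_ (parityPerm {k})
parityPerm-injective {x = 0ℙ} {0ℙ} _  = refl
parityPerm-injective {x = 0ℙ} {1ℙ} eq = ⊥-elim (idP≢transposition01 eq)
parityPerm-injective {x = 1ℙ} {0ℙ} eq = ⊥-elim (idP≢transposition01 (sym eq))
parityPerm-injective {x = 1ℙ} {1ℙ} _  = refl

profileCode : Profile h n → Fin h → ℕ
profileCode p = toℕ ∘ rank ∘ lookup p

profileCode-act : (p : Profile h n) (φ : Perm h) (i : Fin h) →
  profileCode (act p (φ , idP)) i ≡ profileCode p (app (invP φ) i)
profileCode-act p φ i = cong (toℕ ∘ rank) (lookup-act-idP p φ i)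

paritySPF : SPF h (suc (suc n))
paritySPF p = parityPerm (orderParity (profileCode p))

AhId⊆G₁-paritySPF : AhId h (suc (suc n)) ⊆ G₁ (paritySPF {h} {n})
AhId⊆G₁-paritySPF {x = φ , _} (φ-even , refl) = refl , λ p → cong parityPerm (step p)
  where
  step : ∀ p → orderParity (profileCode (act p (φ , idP))) ≡ orderParity (profileCode p)
  step p = trans (orderParity-cong (profileCode-act p φ))
                 (orderParity-∘-even (profileCode p) (invP φ) (trans (sign-invP φ) (IsEven⇒sign≡0ℙ φ φ-even)))

G₁-paritySPF⊆AhId : (q : Profile h (suc (suc n))) → Injective _≡_ _≡_ (lookup q) →
  G₁ (paritySPF {h} {n}) ⊆ AhId h (suc (suc n))
G₁-paritySPF⊆AhId {h} {n} q q-inj {φ , _} (refl , invariant) =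
  sign≡0ℙ⇒IsEven φ (trans (sym (sign-invP φ)) sign-φ⁻¹) , refl
  where
  code-inj : Injective _≡_ _≡_ (profileCode q)
  code-inj eq = q-inj (rank-injective {suc (suc n)} (toℕ-injective eq))
  sign-φ⁻¹ : sign (invP φ) ≡ 0ℙ
  sign-φ⁻¹ = ℙₚ.+-cancelˡ-≡ (orderParity (profileCode q)) (sign (invP φ)) 0ℙ (begin
    orderParity (profileCode q) ℙ.+ sign (invP φ)     ≡⟨ orderParity-∘ code-inj (invP φ) ⟨
    orderParity (profileCode q ∘ app (invP φ))       ≡⟨ orderParity-cong (profileCode-act q φ) ⟨
    orderParity (profileCode (act q (φ , idP)))      ≡⟨ parityPerm-injective (invariant q) ⟩
    orderParity (profileCode q)                      ≡⟨ ℙₚ.+-identityʳ (orderParity (profileCode q)) ⟨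
    orderParity (profileCode q) ℙ.+ 0ℙ               ∎)
    where open ≡-Reasoning

-- If n! < h, an anonymity group containing A_h contains the odd transposition (0 1).
AhId∈SPFAG⇒≤ : InSPFAG (suc (suc h)) n (AhId (suc (suc h)) n) → suc (suc h) ≤ n !
AhId∈SPFAG⇒≤ {h} {n} (F , G₁⊆AhId , AhId⊆G₁) with suc (suc h) ℕₚ.≤? n !
... | yes h≤n! = h≤n!
... | no h≰n! = ⊥-elim (ℙₚ.p≢p⁻¹ 0ℙ (trans (sym t01-even) (sign-transposition {h} {0F} {1F} (λ ()))))
  where
  ShId≤𝒫G₁ : ShId (suc (suc h)) n ≤𝒫 G₁ F
  ShId≤𝒫G₁ p v v∈ with u , u∈AhId , eq ← ShId-≤𝒫-AhId {n = n} (ℕₚ.≰⇒> h≰n!) p v v∈ =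
    u , AhId⊆G₁ {u} u∈AhId , eq
  t01∈G₁ : G₁ F (transposition01 , idP)
  t01∈G₁ = ≤𝒫-⊆-G₁ {V = ShId (suc (suc h)) n} (λ g∈ → g∈) ShId≤𝒫G₁ {transposition01 , idP} refl
  t01-even : sign (transposition01 {h}) ≡ 0ℙ
  t01-even = IsEven⇒sign≡0ℙ (transposition01 {h}) (proj₁ (G₁⊆AhId {transposition01 , idP} t01∈G₁))

≤⇒AhId∈SPFAG : h ≤ suc (suc n) ! → InSPFAG h (suc (suc n)) (AhId h (suc (suc n)))
≤⇒AhId∈SPFAG {h} {n} h≤n! =
  paritySPF ,
  (λ {g} → G₁-paritySPF⊆AhId q (injectiveProfile-injective {h} {suc (suc n)} h≤n!) {g}) ,
  (λ {g} → AhId⊆G₁-paritySPF {h} {n} {g})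
  where
  q : Profile h (suc (suc n))
  q = injectiveProfile h≤n!

proposition55 : ∀ (h n : ℕ) → 2 ≤ h → 2 ≤ n →
    (h ≤ n ! → O (AhId h n) ≐ AhId h n)
    × (n ! < h → O (AhId h n) ≐ ShId h n)
    × (InSPFAG h n (AhId h n) ⇔ h ≤ n !)
proposition55 (suc (suc h)) (suc (suc n)) (s≤s (s≤s z≤n)) (s≤s (s≤s z≤n)) =
  O-AhId≐AhId , O-AhId≐ShId , mk⇔ AhId∈SPFAG⇒≤ ≤⇒AhId∈SPFAG
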